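{- For every integer $b>78557$ there exist infinitely many $b$-repdigits that are Sierpiński numbers.
   Context: For integers $b\ge2$, $1\le k<b$, $t\ge1$, the $b$-repdigit $k_b^{(t)}$ is $k(b^t-1)/(b-1)$, the digit $k$ repeated $t$ times in base $b$. A Sierpiński number is an odd positive integer $k$ such that $k\cdot 2^n+1$ is composite for all positive integers $n$. -}

module Defs where

open import Data.Nat using (ℕ; suc; _+_; _*_; _∸_; _^_; _≤_; _<_; _%_; _/_)
open import Data.Nat.Primality using (Composite)
open import Data.Product using (Σ; _×_; ∃-syntax)
open import Relation.Binary.PropositionalEquality using (_≡_)

-- For b ≥ 2 the division is exact; we write the divisor as suc (b ∸ 2),
-- which equals b - 1 when b ≥ 2 (and makes the NonZero instance automatic).
repunit : ℕ → ℕ → ℕ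
repunit b t = (b ^ t ∸ 1) / suc (b ∸ 2)

repdigit : ℕ → ℕ → ℕ → ℕ
repdigit b k t = k * repunit b t

IsRepdigit : ℕ → ℕ → Set
IsRepdigit b m = ∃[ k ] ∃[ t ] (1 ≤ k × k < b × 1 ≤ t × m ≡ repdigit b k t)

Sierpinski : ℕ → Set
Sierpinski k = k % 2 ≡ 1 × 1 ≤ k × (∀ n → 1 ≤ n → Composite (k * 2 ^ n + 1))

{-# OPTIONS --safe #-}
-- 78557 is a Sierpiński number with covering set {3, 5, 7, 13, 19, 37, 73}: all of these primes
-- divide 2^36 − 1, and each 78557·2^s + 1 with s < 36 is divisible by one of them. Writing R_b
-- for the b-repunit, p divides b·R_b(p(p − 1)) for every base b and prime p (Fermat), hence
-- b·R_b(QN) for Q = lcm p(p − 1) over 2 and the covering primes. So the repdigit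
-- m = 78557·R_b(1 + QN) = 78557·(1 + b·R_b(QN)) is congruent to 78557 modulo 2 and modulo every
-- covering prime: m is odd and every m·2^n + 1 has the same prime factor as 78557·2^n + 1, which
-- is smaller than m. Finally m ≥ R_b(1 + QN) ≥ 1 + QN > N.
module Submission where

open import Defs
open import Data.Nat using (ℕ; _<_)
open import Data.Product using (Σ; _×_; ∃-syntax)

open import Data.Fin using (Fin; toℕ)
open import Data.Fin.Properties using (all?)
open import Data.List using (List; []; _∷_)
open import Data.List.Membership.Propositional using (_∈_; find)
open import Data.List.Relation.Unary.All as All using (All; []; _∷_)
open import Data.List.Relation.Unary.Any as Any using (Any)
open import Data.Nat
open import Data.Nat.DivMod
open import Data.Nat.Divisibility
open import Data.Nat.Properties
open import Data.Nat.Solver using (module +-*-Solver)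
open import Data.Product using (_,_; map₂)
open import Relation.Binary.PropositionalEquality
open import Relation.Nullary.Decidable using (True; toWitness; _×-dec_)

open +-*-Solver using (solve; _:=_; _:+_; _:*_; con)
open ≡-Reasoning

repunit′ : ℕ → ℕ → ℕ
repunit′ b zero    = 0
repunit′ b (suc t) = suc (b * repunit′ b t)

^≡1+pred*repunit′ : ∀ b .{{_ : NonZero b}} t → b ^ t ≡ suc (pred b * repunit′ b t)
^≡1+pred*repunit′ (suc c) zero    = cong suc (sym (*-zeroʳ c))
^≡1+pred*repunit′ (suc c) (suc t) = begin
  suc c * suc c ^ t         ≡⟨ cong (suc c *_) (^≡1+pred*repunit′ (suc c) t) ⟩
  suc c * suc (c * R)       ≡⟨ solve 2 (λ c R → (con 1 :+ c) :* (con 1 :+ c :* R)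
                                          := con 1 :+ c :* (con 1 :+ (con 1 :+ c) :* R)) refl c R ⟩
  suc (c * suc (suc c * R)) ∎
  where
  R : ℕ
  R = repunit′ (suc c) t

repunit≡repunit′ : ∀ {b} → 1 < b → ∀ t → repunit b t ≡ repunit′ b t
repunit≡repunit′ {b@(suc (suc d))} (s≤s (s≤s z≤n)) t = begin
  (b ^ t ∸ 1) / suc d          ≡⟨ cong (λ x → (x ∸ 1) / suc d) (^≡1+pred*repunit′ b t) ⟩
  suc d * repunit′ b t / suc d ≡⟨ cong (_/ suc d) (*-comm (suc d) (repunit′ b t)) ⟩
  repunit′ b t * suc d / suc d ≡⟨ m*n/n≡m (repunit′ b t) (suc d) ⟩
  repunit′ b t                 ∎

repunit′-+ : ∀ b m n → repunit′ b (m + n) ≡ repunit′ b m + b ^ m * repunit′ b n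
repunit′-+ b zero    n = sym (*-identityˡ (repunit′ b n))
repunit′-+ b (suc m) n = cong suc (begin
  b * repunit′ b (m + n)                        ≡⟨ cong (b *_) (repunit′-+ b m n) ⟩
  b * (repunit′ b m + b ^ m * repunit′ b n)     ≡⟨ *-distribˡ-+ b (repunit′ b m) _ ⟩
  b * repunit′ b m + b * (b ^ m * repunit′ b n) ≡⟨ cong (b * repunit′ b m +_) (*-assoc b (b ^ m) _) ⟨
  b * repunit′ b m + b * b ^ m * repunit′ b n   ∎)

repunit′-* : ∀ b m n → repunit′ b (m * n) ≡ repunit′ b m * repunit′ (b ^ m) n
repunit′-* b m zero    = trans (cong (repunit′ b) (*-zeroʳ m)) (sym (*-zeroʳ (repunit′ b m)))
repunit′-* b m (suc n) = begin
  repunit′ b (m * suc n)                ≡⟨ cong (repunit′ b) (*-suc m n) ⟩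
  repunit′ b (m + m * n)                ≡⟨ repunit′-+ b m (m * n) ⟩
  R + b ^ m * repunit′ b (m * n)        ≡⟨ cong (λ x → R + b ^ m * x) (repunit′-* b m n) ⟩
  R + b ^ m * (R * repunit′ (b ^ m) n)  ≡⟨ solve 3 (λ R x S → R :+ x :* (R :* S) := R :* (con 1 :+ x :* S))
                                                   refl R (b ^ m) (repunit′ (b ^ m) n) ⟩
  R * suc (b ^ m * repunit′ (b ^ m) n)  ∎
  where
  R : ℕ
  R = repunit′ b m

n≤repunit′ : ∀ b .{{_ : NonZero b}} n → n ≤ repunit′ b n
n≤repunit′ b zero    = z≤n
n≤repunit′ b (suc n) = s≤s (≤-trans (n≤repunit′ b n) (m≤n*m (repunit′ b n) b))

%-cong-+ : ∀ {a b c d} n .{{_ : NonZero n}} → a % n ≡ b % n → c % n ≡ d % n → (a + c) % n ≡ (b + d) % n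
%-cong-+ {a} {b} {c} {d} n a≡b c≡d = begin
  (a + c) % n             ≡⟨ %-distribˡ-+ a c n ⟩
  (a % n + c % n) % n     ≡⟨ cong₂ (λ x y → (x + y) % n) a≡b c≡d ⟩
  (b % n + d % n) % n     ≡⟨ %-distribˡ-+ b d n ⟨
  (b + d) % n             ∎

%-cong-* : ∀ {a b c d} n .{{_ : NonZero n}} → a % n ≡ b % n → c % n ≡ d % n → a * c % n ≡ b * d % n
%-cong-* {a} {b} {c} {d} n a≡b c≡d = begin
  a * c % n               ≡⟨ %-distribˡ-* a c n ⟩
  a % n * (c % n) % n     ≡⟨ cong₂ (λ x y → x * y % n) a≡b c≡d ⟩
  b % n * (d % n) % n     ≡⟨ %-distribˡ-* b d n ⟨
  b * d % n               ∎

repunit′-cong-% : ∀ {a b} n .{{_ : NonZero n}} t → a % n ≡ b % n → repunit′ a t % n ≡ repunit′ b t % n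
repunit′-cong-% n zero    a≡b = refl
repunit′-cong-% n (suc t) a≡b = %-cong-+ {1} n refl (%-cong-* n a≡b (repunit′-cong-% n t a≡b))

-- Equivalently, repunit′ b (suc L) ≡ 1 (mod p) for every base b.
RepunitPeriod : ℕ → ℕ → Set
RepunitPeriod p L = ∀ b → p ∣ b * repunit′ b L

repunitPeriod-byResidues : ∀ {p L} .{{_ : NonZero p}} →
  (∀ (r : Fin p) → p ∣ toℕ r * repunit′ (toℕ r) L) → RepunitPeriod p L
repunitPeriod-byResidues {p} {L} residues b with b divMod p
... | result q r refl = m%n≡0⇒n∣m _ p (begin
  b * repunit′ b L % p              ≡⟨ %-cong-* p b≡r (repunit′-cong-% p L b≡r) ⟩
  toℕ r * repunit′ (toℕ r) L % p    ≡⟨ n∣m⇒m%n≡0 _ p (residues r) ⟩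
  0                                 ∎)
  where
  b≡r : b % p ≡ toℕ r % p
  b≡r = [m+kn]%n≡m%n (toℕ r) q p

repunitPeriod-∣ : ∀ {p L M} → RepunitPeriod p L → L ∣ M → RepunitPeriod p M
repunitPeriod-∣ {p} {L} period (divides j refl) b = subst (p ∣_) factorise (∣m⇒∣m*n _ (period b))
  where
  factorise : b * repunit′ b L * repunit′ (b ^ L) j ≡ b * repunit′ b (j * L)
  factorise = begin
    b * repunit′ b L * repunit′ (b ^ L) j   ≡⟨ *-assoc b _ _ ⟩
    b * (repunit′ b L * repunit′ (b ^ L) j) ≡⟨ cong (b *_) (repunit′-* b L j) ⟨
    b * repunit′ b (L * j)                  ≡⟨ cong (λ n → b * repunit′ b n) (*-comm L j) ⟩
    b * repunit′ b (j * L)                  ∎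

CoveringSet : List ℕ → ℕ → Set
CoveringSet P k = ∀ n → ∃[ p ] (p ∈ P × p ∣ k * 2 ^ n + 1)

∣-*suc+1 : ∀ {p D x} k → p ∣ D → p ∣ k * x + 1 → p ∣ k * suc D * x + 1
∣-*suc+1 {p} {D} {x} k p∣D p∣kx+1 =
  subst (p ∣_) (sym regroup) (∣m∣n⇒∣m+n p∣kx+1 (∣m⇒∣m*n (k * x) p∣D))
  where
  regroup : k * suc D * x + 1 ≡ k * x + 1 + D * (k * x)
  regroup = solve 3 (λ k D x → k :* (con 1 :+ D) :* x :+ con 1 := k :* x :+ con 1 :+ D :* (k :* x)) refl k D x

∣-*^+1 : ∀ {p y} k x .{{_ : NonZero x}} q → p ∣ pred x → p ∣ k * y + 1 → p ∣ k * (y * x ^ q) + 1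
∣-*^+1 {p} {y} k x q p∣x-1 p∣ky+1 =
  subst (p ∣_) (sym regroup) (∣m∣n⇒∣m+n p∣ky+1 (∣m⇒∣m*n (k * y * R) p∣x-1))
  where
  R : ℕ
  R = repunit′ x q
  regroup : k * (y * x ^ q) + 1 ≡ k * y + 1 + pred x * (k * y * R)
  regroup = begin
    k * (y * x ^ q) + 1               ≡⟨ cong (λ z → k * (y * z) + 1) (^≡1+pred*repunit′ x q) ⟩
    k * (y * suc (pred x * R)) + 1    ≡⟨ solve 4 (λ k y c R → k :* (y :* (con 1 :+ c :* R)) :+ con 1
                                                   := k :* y :+ con 1 :+ c :* (k :* y :* R)) refl k y (pred x) R ⟩
    k * y + 1 + pred x * (k * y * R)  ∎

coveringSet-periodic : ∀ {P} k e .{{_ : NonZero e}} → All (_∣ 2 ^ e ∸ 1) P →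
  (∀ (s : Fin e) → Any (_∣ k * 2 ^ toℕ s + 1) P) → CoveringSet P k
coveringSet-periodic k e P∣2^e-1 covered n with n divMod e
... | result q s refl = let p , p∈P , p∣ = find (covered s) in
  p , p∈P , subst (λ x → p ∣ k * x + 1) (sym 2^[s+q*e])
                  (∣-*^+1 k (2 ^ e) {{m^n≢0 2 e}} q (All.lookup P∣2^e-1 p∈P) p∣)
  where
  2^[s+q*e] : 2 ^ (toℕ s + q * e) ≡ 2 ^ toℕ s * (2 ^ e) ^ q
  2^[s+q*e] = begin
    2 ^ (toℕ s + q * e)     ≡⟨ ^-distribˡ-+-* 2 (toℕ s) (q * e) ⟩
    2 ^ toℕ s * 2 ^ (q * e) ≡⟨ cong (λ i → 2 ^ toℕ s * 2 ^ i) (*-comm q e) ⟩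
    2 ^ toℕ s * 2 ^ (e * q) ≡⟨ cong (2 ^ toℕ s *_) (^-*-assoc 2 e q) ⟨
    2 ^ toℕ s * (2 ^ e) ^ q ∎

coveringSet-lift : ∀ {P D} k → All (_∣ D) P → CoveringSet P k → CoveringSet P (k * suc D)
coveringSet-lift k P∣D covered n = let p , p∈P , p∣ = covered n in
  p , p∈P , ∣-*suc+1 k (All.lookup P∣D p∈P) p∣

[k*[1+D]]%p≡k%p : ∀ {p D} k .{{_ : NonZero p}} → p ∣ D → k * suc D % p ≡ k % p
[k*[1+D]]%p≡k%p {D = D} k p∣D = trans (cong (_% _) (*-suc k D)) (%-remove-+ʳ k (∣n⇒∣m*n k p∣D))

coveredOdd⇒sierpinski : ∀ {P} m → m % 2 ≡ 1 → All (λ p → 1 < p × p ≤ m) P → CoveringSet P m →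
  Sierpinski m
coveredOdd⇒sierpinski m@(suc _) odd bounds covered = odd , s≤s z≤n , λ n _ →
  let p , p∈P , p∣ = covered n ; 1<p , p≤m = All.lookup bounds p∈P in
  hasNonTrivialDivisor {{n>1⇒nonTrivial 1<p}}
    (≤-<-trans (≤-trans p≤m (m≤m*n m (2 ^ n) {{m^n≢0 2 n}})) (m<m+n _ z<s)) p∣

sierpinski-*repunit′ : ∀ {P} k b Q N → k % 2 ≡ 1 → All (λ p → 1 < p × p ≤ k) P → CoveringSet P k →
  All (λ p → RepunitPeriod p Q) (2 ∷ P) → Sierpinski (k * repunit′ b (suc (Q * N)))
sierpinski-*repunit′ {P} k b Q N k-odd k-bounds k-covered periods =
  coveredOdd⇒sierpinski (k * suc D)
    (trans ([k*[1+D]]%p≡k%p k (All.head 2∷P∣D)) k-odd)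
    (All.map (map₂ (λ p≤k → ≤-trans p≤k (m≤m*n k (suc D)))) k-bounds)
    (coveringSet-lift k (All.tail 2∷P∣D) k-covered)
  where
  D : ℕ
  D = b * repunit′ b (Q * N)

  2∷P∣D : All (_∣ D) (2 ∷ P)
  2∷P∣D = All.map (λ period → repunitPeriod-∣ period (m∣m*n N) b) periods

coveringPrimes : List ℕ
coveringPrimes = 3 ∷ 5 ∷ 7 ∷ 13 ∷ 19 ∷ 37 ∷ 73 ∷ []

coveringPrimes-bounds : All (λ p → 1 < p × p ≤ 78557) coveringPrimes
coveringPrimes-bounds = toWitness {a? = All.all? (λ p → 1 <? p ×-dec p ≤? 78557) coveringPrimes} _

78557-coveringSet : CoveringSet coveringPrimes 78557
78557-coveringSet = coveringSet-periodic 78557 36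
  (toWitness {a? = All.all? (_∣? 2 ^ 36 ∸ 1) coveringPrimes} _)
  (toWitness {a? = all? λ s → Any.any? (_∣? 78557 * 2 ^ toℕ s + 1) coveringPrimes} _)

-- The least common multiple of p (p − 1) over p ∈ 2 ∷ coveringPrimes.
Q : ℕ
Q = 1681210440

Q-repunitPeriod : All (λ p → RepunitPeriod p Q) (2 ∷ coveringPrimes)
Q-repunitPeriod =
  checked 2 ∷ checked 3 ∷ checked 5 ∷ checked 7 ∷ checked 13 ∷ checked 19 ∷ checked 37 ∷ checked 73 ∷ []
  where
  checked : ∀ p .{{_ : NonZero p}} →
    {True (all? λ (r : Fin p) → p ∣? toℕ r * repunit′ (toℕ r) (p * pred p))} →
    {True (p * pred p ∣? Q)} → RepunitPeriod p Q
  checked p {residues} {p[p-1]∣Q} =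
    repunitPeriod-∣ (repunitPeriod-byResidues (toWitness residues)) (toWitness p[p-1]∣Q)

corollary3p7 : ∀ (b : ℕ) → 78557 < b →
    ∀ (N : ℕ) → ∃[ m ] (N < m × IsRepdigit b m × Sierpinski m)
corollary3p7 b 78557<b N =
  m , N<m , (78557 , t , s≤s z≤n , 78557<b , s≤s z≤n , m≡repdigit) , m-sierpinski
  where
  t m : ℕ
  t = suc (Q * N)
  m = 78557 * repunit′ b t

  N<m : N < m
  N<m = <-≤-trans (s≤s (m≤n*m N Q)) (≤-trans (n≤repunit′ b {{b≢0}} t) (m≤n*m (repunit′ b t) 78557))
    where
    b≢0 : NonZero b
    b≢0 = >-nonZero (≤-trans (s≤s z≤n) 78557<b)

  m≡repdigit : m ≡ repdigit b 78557 t
  m≡repdigit = cong (78557 *_) (sym (repunit≡repunit′ (≤-trans (s≤s (s≤s z≤n)) 78557<b) t))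

  m-sierpinski : Sierpinski m
  m-sierpinski =
    sierpinski-*repunit′ 78557 b Q N refl coveringPrimes-bounds 78557-coveringSet Q-repunitPeriod
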